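{- Let $k\ge 2$, let $G$ be a graph and let $x,y,z\in V(G)$ be distinct vertices. Let $G'=\mathcal C_k(G,x,y,z)$. Then in every $k$-C-E ordering $\phi$ of $G'$, the vertex $y$ lies between $x$ and $z$.
   Context: All graphs are finite, simple and undirected. For an ordering $\phi$ of $V(G)$ write $a<_\phi b$ if $a$ precedes $b$; $w$ lies between $a$ and $b$ if $a<_\phi w<_\phi b$ or $b<_\phi w<_\phi a$. An ordering $\phi$ of $V(G)$ is a $k$-clique-extendible ordering ($k$-C-E ordering) of $G$ if whenever $X$ and $Y$ are cliques of size $k$ with $|X\cap Y|=k-1$, $X\setminus Y=\{a\}$, $Y\setminus X=\{b\}$, and all vertices of $X\cap Y$ lie between $a$ and $b$ in $\phi$, then $ab\in E(G)$. The graph $F_k$ has vertex set $K\cup I$, where $K=\{v_1,\dots,v_{2k-1}\}$ is a clique and $I=\{u_{i,j}: 1\le i<j\le 2k-1\}$ is an independent set, with $u_{i,j}$ adjacent to every vertex of $K$ except $v_i$ and $v_j$ and to nothing else; $\Gamma_k$ is $F_k$ with $u_{1,2}$ deleted. The graph $\mathcal C_k(G,x,y,z)$ is obtained from the disjoint union of $G$ and $\Gamma_k$ by identifying $x$ with $v_1$, $y$ with $v_3$, and $z$ with $v_2$ (identifying two vertices means replacing them by a single vertex adjacent to the union of their neighbourhoods). -}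

module Defs where

open import Level using (0ℓ)
open import Data.Nat using (ℕ; zero; suc; _+_; _*_; _∸_; _≤_; _<_)
open import Data.Fin using (Fin)
open import Data.Unit using (⊤; tt)
open import Data.Empty using (⊥)
open import Data.Product using (Σ; Σ-syntax; ∃; _×_; _,_)
open import Data.Sum using (_⊎_)
open import Data.List using (List; length)
open import Data.List.Membership.Propositional using (_∈_; _∉_)
open import Data.List.Relation.Unary.Unique.Propositional using (Unique)
open import Relation.Nullary using (¬_)
open import Relation.Binary.PropositionalEquality using (_≡_; _≢_)
open import Relation.Binary.Structures using (IsStrictTotalOrder)
open import Function.Bundles using (_⇔_; _↔_)

record Graph : Set₁ where
  field
    V      : Set
    Adj    : V → V → Set
    sym    : ∀ {a b} → Adj a b → Adj b a
    irrefl : ∀ {a} → ¬ Adj a a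
open Graph public

Finite : Graph → Set
Finite G = Σ[ n ∈ ℕ ] (Fin n ↔ V G)

record Ordering (V : Set) : Set₁ where
  field
    _<φ_ : V → V → Set
    isSTO : IsStrictTotalOrder _≡_ _<φ_
open Ordering public

Between : {V : Set} → Ordering V → V → V → V → Set
Between φ a w b = (_<φ_ φ a w × _<φ_ φ w b) ⊎ (_<φ_ φ b w × _<φ_ φ w a)

HasSize : {V : Set} → (V → Set) → ℕ → Set
HasSize {V} P m =
  Σ[ Z ∈ List V ] (Unique Z × length Z ≡ m × (∀ w → (w ∈ Z) ⇔ P w))

IsClique : {V : Set} → (V → V → Set) → ℕ → List V → Set
IsClique Adj k X =
  Unique X × length X ≡ k × (∀ a b → a ∈ X → b ∈ X → a ≢ b → Adj a b)

IsCEOrdering : (k : ℕ) → {V : Set} → (Adj : V → V → Set) → Ordering V → Set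
IsCEOrdering k {V} Adj φ =
  ∀ (X Y : List V) → IsClique Adj k X → IsClique Adj k Y →
  HasSize (λ w → w ∈ X × w ∈ Y) (k ∸ 1) →
  ∀ (a b : V) →
  (∀ w → (w ∈ X × w ∉ Y) ⇔ (w ≡ a)) →
  (∀ w → (w ∈ Y × w ∉ X) ⇔ (w ≡ b)) →
  (∀ w → w ∈ X → w ∈ Y → Between φ a w b) →
  Adj a b

-- The graph Γ_k (= F_k minus u_{1,2}); indices are 1-based as in the paper.
-- v i  is v_i  (1 ≤ i ≤ 2k-1),  u i j  is u_{i,j}  (1 ≤ i < j ≤ 2k-1, (i,j) ≠ (1,2)).
-- Bound proofs are irrelevant, so vertices are determined by their indices.

data ΓV (k : ℕ) : Set where
  v : (i : ℕ) → .(1 ≤ i) → .(i ≤ 2 * k ∸ 1) → ΓV k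
  u : (i j : ℕ) → .(1 ≤ i) → .(i < j) → .(j ≤ 2 * k ∸ 1) →
      .(¬ (i ≡ 1 × j ≡ 2)) → ΓV k

ΓAdj : {k : ℕ} → ΓV k → ΓV k → Set
ΓAdj (v i _ _)       (v j _ _)       = i ≢ j
ΓAdj (v l _ _)       (u i j _ _ _ _) = l ≢ i × l ≢ j
ΓAdj (u i j _ _ _ _) (v l _ _)       = l ≢ i × l ≢ j
ΓAdj (u _ _ _ _ _ _) (u _ _ _ _ _ _) = ⊥

-- C_k(G,x,y,z): disjoint union of G and Γ_k with x ~ v_1, y ~ v_3, z ~ v_2
-- identified.  Vertices: old vertices of G, plus vertices of Γ_k other
-- than v_1, v_2, v_3.

NotIdentified : {k : ℕ} → ΓV k → Set
NotIdentified (v 1 _ _) = ⊥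
NotIdentified (v 2 _ _) = ⊥
NotIdentified (v 3 _ _) = ⊥
NotIdentified _         = ⊤

data CV (V : Set) (k : ℕ) : Set where
  old : V → CV V k
  new : (s : ΓV k) → .(NotIdentified s) → CV V k

ιΓ : {V : Set} {k : ℕ} → V → V → V → ΓV k → CV V k
ιΓ x y z (v 1 _ _) = old x
ιΓ x y z (v 2 _ _) = old z
ιΓ x y z (v 3 _ _) = old y
ιΓ x y z s@(v 0 _ _) = new s tt
ιΓ x y z s@(v (suc (suc (suc (suc _)))) _ _) = new s tt
ιΓ x y z s@(u _ _ _ _ _ _) = new s tt

CkAdj : (G : Graph) (k : ℕ) (x y z : V G) → CV (V G) k → CV (V G) k → Set
CkAdj G k x y z p q =
  (Σ[ a ∈ V G ] Σ[ b ∈ V G ] (old a ≡ p × old b ≡ q × Adj G a b))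
  ⊎ (Σ[ s ∈ ΓV k ] Σ[ t ∈ ΓV k ] (ιΓ x y z s ≡ p × ιΓ x y z t ≡ q × ΓAdj s t))

-- Sort the clique K = {v₁, …, v_{2k-1}} of Γ_k along φ.  If its φ-extremes were v_i and v_j with
-- {i, j} ≠ {1, 2}, the vertex u_{i,j} would be adjacent to all of K except v_i and v_j.  Compare
-- u_{i,j} with the median c of K.  If c precedes u_{i,j}, the k-1 vertices of K after the minimum
-- up to c lie between u_{i,j} and the minimum; adding u_{i,j}, respectively the minimum, to them
-- gives two k-cliques, so clique-extendibility makes u_{i,j} adjacent to the minimum.  Otherwise,
-- symmetrically, u_{i,j} is adjacent to the maximum.  Hence the φ-extremes of K are v₁ = x and
-- v₂ = z, and y = v₃ lies between them.
module Submission where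

open import Defs hiding (sym; _<φ_)
open import Level using (0ℓ)
open import Data.Nat using (ℕ; zero; suc; _+_; _*_; _∸_; _≤_; _<_; z≤n; s≤s; _≟_)
open import Data.Nat.Properties using (+-suc; ≤-trans; m≤n+m; <-cmp; suc-injective)
open import Data.Fin using (Fin; toℕ; fromℕ<)
open import Data.Fin.Properties using (toℕ<n; toℕ-injective; toℕ-fromℕ<)
open import Data.Product using (∃-syntax; ∃₂; Σ-syntax; _×_; _,_; proj₁; proj₂)
import Data.Product as Product
open import Data.Sum using (_⊎_; inj₁; inj₂) renaming (swap to ⊎-swap)
open import Data.Empty using (⊥; ⊥-elim)
open import Data.List using (List; []; _∷_; _++_; [_]; length; map; allFin)
open import Data.List.Properties using (++-assoc; length-map; length-tabulate)
open import Data.List.Relation.Unary.All as All using (All; []; _∷_)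
open import Data.List.Relation.Unary.All.Properties using (¬Any⇒All¬)
import Data.List.Relation.Unary.All.Properties as All
open import Data.List.Relation.Unary.AllPairs as AllPairs using (AllPairs; []; _∷_)
open import Data.List.Relation.Unary.Any using (here; there)
open import Data.List.Membership.Propositional using (_∈_; _∉_)
open import Data.List.Membership.Propositional.Properties using (∈-++⁻; ∈-++⁺ʳ; ∈-map⁺; ∈-allFin)
open import Data.List.Relation.Unary.Unique.Propositional using (Unique)
import Data.List.Relation.Unary.Unique.Propositional.Properties as Unique
open import Data.List.Relation.Binary.Permutation.Propositional using (_↭_; ↭-sym; ↭⇒↭ₛ)
open import Data.List.Relation.Binary.Permutation.Propositional.Properties using (↭-length; All-resp-↭; ∈-resp-↭)
open import Data.List.Relation.Binary.Permutation.Setoid.Properties using (Unique-resp-↭)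
open import Data.List.Relation.Unary.Sorted.TotalOrder.Properties using (Sorted⇒AllPairs)
open import Function using (_∘_; id; _⇔_; mk⇔)
open import Relation.Nullary using (¬_; _×-dec_)
open import Relation.Nullary.Decidable using (decidable-stable)
open import Relation.Binary.Bundles using (StrictTotalOrder)
open import Relation.Binary.Definitions using (Tri; tri<; tri≈; tri>)
open import Relation.Binary.Structures using (IsStrictTotalOrder)
open import Relation.Binary.PropositionalEquality
  using (_≡_; _≢_; refl; sym; trans; cong; subst; setoid)

module _ {A : Set} where

  ++-split : ∀ m n (xs : List A) → length xs ≡ m + n →
             ∃₂ λ ys zs → xs ≡ ys ++ zs × length ys ≡ m × length zs ≡ n
  ++-split zero    n xs       |xs| = [] , xs , refl , refl , |xs|
  ++-split (suc m) n []       ()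
  ++-split (suc m) n (x ∷ xs) |xs| with ++-split m n xs (suc-injective |xs|)
  ... | ys , zs , refl , |ys| , |zs| = x ∷ ys , zs , refl , cong suc |ys| , |zs|

  median-split : ∀ n (xs : List A) → length xs ≡ suc n + suc (n + 1) →
                 ∃[ mn ] ∃[ P ] ∃[ c ] ∃[ Q ] ∃[ mx ]
                   (xs ≡ mn ∷ P ++ c ∷ Q ++ [ mx ] × length P ≡ n × length Q ≡ n)
  median-split n xs |xs| with ++-split (suc n) (suc (n + 1)) xs |xs|
  ... | []     , _     , _    , ()  , _
  ... | _ ∷ _  , []    , _    , _   , ()
  ... | mn ∷ P , c ∷ R , refl , |P| , |R| with ++-split n 1 R (suc-injective |R|)
  ...   | Q , mx ∷ [] , refl , |Q| , _ = mn , P , c , Q , mx , refl , suc-injective |P| , |Q|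

  median-last-∈ : ∀ {c mx : A} P Q → mx ∈ P ++ c ∷ Q ++ [ mx ]
  median-last-∈ P Q = ∈-++⁺ʳ P (there (∈-++⁺ʳ Q (here refl)))

module _ {A : Set} {R : A → A → Set} where

  AllPairs-++⁻ : ∀ xs {ys} → AllPairs R (xs ++ ys) → AllPairs R xs × AllPairs R ys
  AllPairs-++⁻ []       rs        = [] , rs
  AllPairs-++⁻ (x ∷ xs) (rx ∷ rs) = Product.map₁ (All.++⁻ˡ xs rx ∷_) (AllPairs-++⁻ xs rs)

  AllPairs-window : ∀ {a b ys} xs → AllPairs R (a ∷ xs ++ b ∷ ys) → All (λ w → R a w × R w b) xs
  AllPairs-window []       _                          = []
  AllPairs-window (x ∷ xs) ((ax ∷ ra) ∷ rx ∷ rs) =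
    (ax , All.lookup rx (∈-++⁺ʳ xs (here refl))) ∷ AllPairs-window xs (ra ∷ rs)

  AllPairs-interior : ∀ {a b w} xs → AllPairs R (a ∷ xs ++ [ b ]) → w ∈ a ∷ xs ++ [ b ] →
                      w ≢ a → w ≢ b → R a w × R w b
  AllPairs-interior xs rs (here w≡a) w≢a _ = ⊥-elim (w≢a w≡a)
  AllPairs-interior xs rs (there w∈) w≢a w≢b with ∈-++⁻ xs w∈
  ... | inj₁ w∈xs       = All.lookup (AllPairs-window xs rs) w∈xs
  ... | inj₂ (here w≡b) = ⊥-elim (w≢b w≡b)

module _ {W : Set} (φ : Ordering W) where

  open Ordering φ using (_<φ_)
  open IsStrictTotalOrder (isSTO φ) using () renaming (trans to <-trans; irrefl to <-irrefl)

  <φ⇒≢ : ∀ {a b} → a <φ b → a ≢ b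
  <φ⇒≢ a<b refl = <-irrefl refl a<b

  Between-sym : ∀ {a w b} → Between φ a w b → Between φ b w a
  Between-sym = ⊎-swap

  Between-irreflˡ : ∀ {a b} → ¬ Between φ a a b
  Between-irreflˡ (inj₁ (a<a , _)) = <-irrefl refl a<a
  Between-irreflˡ (inj₂ (_ , a<a)) = <-irrefl refl a<a

  Between-irreflʳ : ∀ {a b} → ¬ Between φ a b b
  Between-irreflʳ = Between-irreflˡ ∘ Between-sym

  Between-≢ʳ : ∀ {a w b} → Between φ a w b → w ≢ b
  Between-≢ʳ a-w-b refl = Between-irreflʳ a-w-b

  Between⇒≢ : ∀ {a w b} → Between φ a w b → a ≢ b
  Between⇒≢ (inj₁ (a<w , w<a)) refl = <-irrefl refl (<-trans a<w w<a)
  Between⇒≢ (inj₂ (a<w , w<a)) refl = <-irrefl refl (<-trans a<w w<a)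

  median-interior-between : ∀ {mn c mx w} P Q → AllPairs _<φ_ (mn ∷ P ++ c ∷ Q ++ [ mx ]) →
                            w ∈ mn ∷ P ++ c ∷ Q ++ [ mx ] → w ≢ mn → w ≢ mx → Between φ mn w mx
  median-interior-between {mn} {c} {mx} {w} P Q sorted w∈ w≢mn w≢mx = inj₁ (AllPairs-interior (P ++ c ∷ Q)
    (subst (AllPairs _<φ_) reassoc sorted) (subst (w ∈_) reassoc w∈) w≢mn w≢mx)
    where
    reassoc : mn ∷ P ++ c ∷ Q ++ [ mx ] ≡ mn ∷ (P ++ c ∷ Q) ++ [ mx ]
    reassoc = cong (mn ∷_) (sym (++-assoc P (c ∷ Q) [ mx ]))

  private
    strictTotalOrder : StrictTotalOrder 0ℓ 0ℓ 0ℓ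
    strictTotalOrder = record { isStrictTotalOrder = isSTO φ }

  open import Relation.Binary.Properties.StrictTotalOrder strictTotalOrder
    using (decTotalOrder; totalOrder)
  open import Data.List.Sort decTotalOrder using (sort; sort-↭; sort-↗)

  sort-strict : (xs : List W) → Unique xs → ∃[ ys ] (AllPairs _<φ_ ys × ys ↭ xs)
  sort-strict xs xs! = sort xs , sorted , sort-↭ xs
    where
    sorted : AllPairs _<φ_ (sort xs)
    sorted = AllPairs.zipWith (λ { (inj₁ a<b , _) → a<b ; (inj₂ a≡b , a≢b) → ⊥-elim (a≢b a≡b) })
      ( Sorted⇒AllPairs totalOrder (sort-↗ xs)
      , Unique-resp-↭ (setoid W) (↭⇒↭ₛ (↭-sym (sort-↭ xs))) xs! )

IsClique-∷ : ∀ {W : Set} {A : W → W → Set} → (∀ {a b} → A a b → A b a) →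
             ∀ {m c S} → IsClique A m S → c ∉ S → All (A c) S → IsClique A (suc m) (c ∷ S)
IsClique-∷ {A = A} A-sym {c = c} {S} (S! , |S| , S-adj) c∉S c-adj =
  ¬Any⇒All¬ S c∉S ∷ S! , cong suc |S| , adj
  where
  adj : ∀ p q → p ∈ c ∷ S → q ∈ c ∷ S → p ≢ q → A p q
  adj _ _ (here refl) (here refl) p≢q = ⊥-elim (p≢q refl)
  adj _ _ (here refl) (there q∈)  _   = All.lookup c-adj q∈
  adj _ _ (there p∈)  (here refl) _   = A-sym (All.lookup c-adj p∈)
  adj p q (there p∈)  (there q∈)  p≢q = S-adj p q p∈ q∈ p≢q

record Separator {W : Set} (A : W → W → Set) (K : W → Set) (a b : W) : Set where
  field
    vertex    : W
    outside   : ¬ K vertex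
    adjacent  : ∀ {w} → K w → w ≢ a → w ≢ b → A vertex w
    ¬adjacentˡ : ¬ A vertex a
    ¬adjacentʳ : ¬ A vertex b

Separator-sym : ∀ {W A K} {a b : W} → Separator A K a b → Separator A K b a
Separator-sym s = record
  { vertex = vertex ; outside = outside ; adjacent = λ Kw w≢b w≢a → adjacent Kw w≢a w≢b
  ; ¬adjacentˡ = ¬adjacentʳ ; ¬adjacentʳ = ¬adjacentˡ }
  where open Separator s

module CliqueExtendible {W : Set} (φ : Ordering W) {A : W → W → Set}
  (A-sym : ∀ {a b} → A a b → A b a) (n : ℕ) (ce : IsCEOrdering (2 + n) A φ) where

  open Ordering φ using (_<φ_)
  open IsStrictTotalOrder (isSTO φ) using (compare) renaming (trans to <-trans)

  adjacent-across : ∀ {a b} (S : List W) → IsClique A (suc n) S → All (A a) S → All (A b) S →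
                    All (λ w → Between φ a w b) S → A a b
  adjacent-across {a} {b} S clique@(S! , |S| , _) a-adj b-adj between =
    ce (a ∷ S) (b ∷ S) (IsClique-∷ A-sym clique a∉S a-adj) (IsClique-∷ A-sym clique b∉S b-adj) common a b
       (only a≢b a∉S) (only (a≢b ∘ sym) b∉S) between-common
    where
    a≢b : a ≢ b
    a≢b = separated S |S| between
      where
      separated : ∀ xs → length xs ≡ suc n → All (λ w → Between φ a w b) xs → a ≢ b
      separated (_ ∷ _) _ (a-w-b ∷ _) = Between⇒≢ φ a-w-b

    a∉S : a ∉ S
    a∉S = Between-irreflˡ φ ∘ All.lookup between

    b∉S : b ∉ S
    b∉S = Between-irreflʳ φ ∘ All.lookup between

    common : HasSize (λ w → w ∈ a ∷ S × w ∈ b ∷ S) (suc n)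
    common = S , S! , |S| , λ w → mk⇔ (λ w∈ → there w∈ , there w∈) λ where
      (there w∈ , _)         → w∈
      (here refl , there w∈) → w∈
      (here refl , here a≡b) → ⊥-elim (a≢b a≡b)

    only : ∀ {c d} → c ≢ d → c ∉ S → ∀ w → (w ∈ c ∷ S × w ∉ d ∷ S) ⇔ (w ≡ c)
    only {c} {d} c≢d c∉S w = mk⇔
      (λ { (here w≡c , _) → w≡c ; (there w∈ , w∉) → ⊥-elim (w∉ (there w∈)) })
      (λ { refl → here refl , λ { (here c≡d) → c≢d c≡d ; (there c∈) → c∉S c∈ } })

    between-common : ∀ w → w ∈ a ∷ S → w ∈ b ∷ S → Between φ a w b
    between-common w (there w∈)  _           = All.lookup between w∈
    between-common w (here refl) (there w∈)  = All.lookup between w∈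
    between-common w (here refl) (here a≡b)  = ⊥-elim (a≢b a≡b)

  separator-adjacent-across : ∀ {K : W → Set} → (∀ {a b} → K a → K b → a ≢ b → A a b) →
    ∀ {mn mx} (sep : Separator A K mn mx) → let U = Separator.vertex sep in
    ∀ {b} (S : List W) → Unique S → length S ≡ suc n → K b →
    All (λ w → K w × mn <φ w × w <φ mx × Between φ U w b) S → A U b
  separator-adjacent-across K-adj sep S S! |S| K-b inside = adjacent-across S
    (S! , |S| , λ p q p∈ q∈ → K-adj (proj₁ (All.lookup inside p∈)) (proj₁ (All.lookup inside q∈)))
    (All.map (λ (K-w , mn<w , w<mx , _) → adjacent K-w (<φ⇒≢ φ mn<w ∘ sym) (<φ⇒≢ φ w<mx)) inside)
    (All.map (λ (K-w , _ , _ , U-w-b) → K-adj K-b K-w (Between-≢ʳ φ U-w-b ∘ sym)) inside)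
    (All.map (λ (_ , _ , _ , U-w-b) → U-w-b) inside)
    where open Separator sep

  extremes-inseparable : ∀ {K : W → Set} → (∀ {a b} → K a → K b → a ≢ b → A a b) →
    ∀ {mn c mx} P Q → AllPairs _<φ_ (mn ∷ P ++ c ∷ Q ++ [ mx ]) →
    All K (mn ∷ P ++ c ∷ Q ++ [ mx ]) → length P ≡ n → length Q ≡ n →
    ¬ Separator A K mn mx
  extremes-inseparable {K} K-adj {mn} {c} {mx} P Q
    sorted@(mn<rest ∷ rest-sorted) (K-mn ∷ K-rest) |P| |Q| sep = by-median (compare c U)
    where
    open Separator sep renaming (vertex to U)

    upper-sorted : AllPairs _<φ_ (c ∷ Q ++ [ mx ])
    upper-sorted = proj₂ (AllPairs-++⁻ P rest-sorted)

    below-c : All (λ w → mn <φ w × w <φ c) P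
    below-c = AllPairs-window P sorted

    above-c : All (λ w → c <φ w × w <φ mx) Q
    above-c = AllPairs-window Q upper-sorted

    mn<c : mn <φ c
    mn<c = All.lookup mn<rest (∈-++⁺ʳ P (here refl))

    c<mx : c <φ mx
    c<mx = All.lookup (AllPairs.head upper-sorted) (∈-++⁺ʳ Q (here refl))

    K-P : All K P
    K-P = All.++⁻ˡ P K-rest

    K-upper : All K (c ∷ Q ++ [ mx ])
    K-upper = All.++⁻ʳ P K-rest

    K-Q : All K Q
    K-Q = All.++⁻ˡ Q (All.tail K-upper)

    K-mx : K mx
    K-mx = All.head (All.++⁻ʳ Q (All.tail K-upper))

    K-c : K c
    K-c = All.head K-upper

    lower-unique : Unique (c ∷ P)
    lower-unique = All.map (λ (_ , w<c) → <φ⇒≢ φ w<c ∘ sym) below-c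
                 ∷ AllPairs.map (<φ⇒≢ φ) (proj₁ (AllPairs-++⁻ P rest-sorted))

    upper-unique : Unique (c ∷ Q)
    upper-unique = All.map (λ (c<w , _) → <φ⇒≢ φ c<w) above-c
                 ∷ AllPairs.map (<φ⇒≢ φ) (proj₁ (AllPairs-++⁻ Q (AllPairs.tail upper-sorted)))

    by-median : Tri (c <φ U) (c ≡ U) (U <φ c) → ⊥
    by-median (tri< c<U _ _) = ¬adjacentˡ (separator-adjacent-across K-adj sep (c ∷ P)
      lower-unique (cong suc |P|) K-mn
      ((K-c , mn<c , c<mx , inj₂ (mn<c , c<U))
       ∷ All.zipWith (λ (K-w , mn<w , w<c) → K-w , mn<w , <-trans w<c c<mx , inj₂ (mn<w , <-trans w<c c<U))
                     (K-P , below-c)))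
    by-median (tri≈ _ c≡U _) = outside (subst K c≡U K-c)
    by-median (tri> _ _ U<c) = ¬adjacentʳ (separator-adjacent-across K-adj sep (c ∷ Q)
      upper-unique (cong suc |Q|) K-mx
      ((K-c , mn<c , c<mx , inj₁ (U<c , c<mx))
       ∷ All.zipWith (λ (K-w , c<w , w<mx) → K-w , <-trans mn<c c<w , w<mx , inj₁ (<-trans U<c c<w , w<mx))
                     (K-Q , above-c)))

module Ck (G : Graph) (n : ℕ) {x y z : V G} (x≢y : x ≢ y) (x≢z : x ≢ z) (y≢z : y ≢ z) where

  k : ℕ
  k = 2 + n

  N : ℕ
  N = 2 * k ∸ 1

  N-median-length : N ≡ suc n + suc (n + 1)
  N-median-length = cong (λ t → suc (n + suc t)) (sym (+-suc n 0))

  W : Set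
  W = CV (V G) k

  ι : ΓV k → W
  ι = ιΓ x y z

  A : W → W → Set
  A = CkAdj G k x y z

  old-injective : ∀ {a b : V G} → old {k = k} a ≡ old b → a ≡ b
  old-injective refl = refl

  v-injective : ∀ {i j} .{p q p′ q′} → v {k} i p q ≡ v j p′ q′ → i ≡ j
  v-injective refl = refl

  ι-v-cong : ∀ {i j} .{p q p′ q′} → i ≡ j → ι (v i p q) ≡ ι (v j p′ q′)
  ι-v-cong refl = refl

  new≡ι⇒≡ : ∀ {s t} .{ns} → new s ns ≡ ι t → s ≡ t
  new≡ι⇒≡ {t = v 0 _ _}                             refl = refl
  new≡ι⇒≡ {t = v (suc (suc (suc (suc _)))) _ _}     refl = refl
  new≡ι⇒≡ {t = u _ _ _ _ _ _}                       refl = refl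

  ι-injective : ∀ s t → ι s ≡ ι t → s ≡ t
  ι-injective (v 0 _ _)                         _ e = new≡ι⇒≡ e
  ι-injective (v (suc (suc (suc (suc _)))) _ _) _ e = new≡ι⇒≡ e
  ι-injective (u _ _ _ _ _ _)                   _ e = new≡ι⇒≡ e
  ι-injective _ (v 0 _ _)                         e = sym (new≡ι⇒≡ (sym e))
  ι-injective _ (v (suc (suc (suc (suc _)))) _ _) e = sym (new≡ι⇒≡ (sym e))
  ι-injective _ (u _ _ _ _ _ _)                   e = sym (new≡ι⇒≡ (sym e))
  ι-injective (v 1 _ _) (v 1 _ _) _ = refl
  ι-injective (v 1 _ _) (v 2 _ _) e = ⊥-elim (x≢z (old-injective e))
  ι-injective (v 1 _ _) (v 3 _ _) e = ⊥-elim (x≢y (old-injective e))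
  ι-injective (v 2 _ _) (v 1 _ _) e = ⊥-elim (x≢z (sym (old-injective e)))
  ι-injective (v 2 _ _) (v 2 _ _) _ = refl
  ι-injective (v 2 _ _) (v 3 _ _) e = ⊥-elim (y≢z (sym (old-injective e)))
  ι-injective (v 3 _ _) (v 1 _ _) e = ⊥-elim (x≢y (sym (old-injective e)))
  ι-injective (v 3 _ _) (v 2 _ _) e = ⊥-elim (y≢z (old-injective e))
  ι-injective (v 3 _ _) (v 3 _ _) _ = refl

  ΓAdj-sym : ∀ (s t : ΓV k) → ΓAdj s t → ΓAdj t s
  ΓAdj-sym (v _ _ _)       (v _ _ _)       i≢j = i≢j ∘ sym
  ΓAdj-sym (v _ _ _)       (u _ _ _ _ _ _) adj = adj
  ΓAdj-sym (u _ _ _ _ _ _) (v _ _ _)       adj = adj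

  A-sym : ∀ {p q} → A p q → A q p
  A-sym (inj₁ (a , b , p≡a , q≡b , a~b)) = inj₁ (b , a , q≡b , p≡a , Graph.sym G a~b)
  A-sym (inj₂ (s , t , p≡s , q≡t , s~t)) = inj₂ (t , s , q≡t , p≡s , ΓAdj-sym s t s~t)

  InK : W → Set
  InK w = ∃[ l ] Σ[ p ∈ 1 ≤ l ] Σ[ q ∈ l ≤ N ] ι (v l p q) ≡ w

  InK-adjacent : ∀ {a b} → InK a → InK b → a ≢ b → A a b
  InK-adjacent (l , p , q , refl) (l′ , p′ , q′ , refl) a≢b =
    inj₂ (v l p q , v l′ p′ q′ , refl , refl , λ { refl → a≢b refl })

  u-separator : ∀ {i j} (pi : 1 ≤ i) (qi : i ≤ N) (pj : 1 ≤ j) (qj : j ≤ N) (i<j : i < j)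
                (not-u₁₂ : ¬ (i ≡ 1 × j ≡ 2)) → Separator A InK (ι (v i pi qi)) (ι (v j pj qj))
  u-separator {i} {j} pi qi pj qj i<j not-u₁₂ = record
    { vertex     = ι uᵢⱼ
    ; outside    = λ (l , p , q , e) → vertex≢v (ι-injective (v l p q) uᵢⱼ e)
    ; adjacent   = λ { (l , p , q , refl) w≢vᵢ w≢vⱼ →
                       inj₂ (uᵢⱼ , v l p q , refl , refl , (λ { refl → w≢vᵢ refl }) , (λ { refl → w≢vⱼ refl })) }
    ; ¬adjacentˡ = non-adjacent {i} (λ s~vᵢ → proj₁ s~vᵢ refl)
    ; ¬adjacentʳ = non-adjacent {j} (λ s~vⱼ → proj₂ s~vⱼ refl)
    }
    where
    uᵢⱼ : ΓV k
    uᵢⱼ = u i j pi i<j qj not-u₁₂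

    vertex≢v : ∀ {l} .{p q} → v l p q ≢ uᵢⱼ
    vertex≢v ()

    non-adjacent : ∀ {l} .{p q} → ¬ ΓAdj uᵢⱼ (v l p q) → ¬ A (ι uᵢⱼ) (ι (v l p q))
    non-adjacent _ (inj₁ (_ , _ , () , _))
    non-adjacent ¬u~v (inj₂ (s , t , s≡u , t≡v , s~t))
      with refl ← ι-injective s uᵢⱼ s≡u | refl ← ι-injective t (v _ _ _) t≡v = ¬u~v s~t

  ordered-extremes : ∀ {i j} (pi : 1 ≤ i) (qi : i ≤ N) (pj : 1 ≤ j) (qj : j ≤ N) → i < j →
                     ¬ Separator A InK (ι (v i pi qi)) (ι (v j pj qj)) → i ≡ 1 × j ≡ 2
  ordered-extremes {i} {j} pi qi pj qj i<j inseparable =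
    decidable-stable (i ≟ 1 ×-dec j ≟ 2) (inseparable ∘ u-separator pi qi pj qj i<j)

  extremes-v₁v₂ : ∀ {i j} (pi : 1 ≤ i) (qi : i ≤ N) (pj : 1 ≤ j) (qj : j ≤ N) →
                  ι (v i pi qi) ≢ ι (v j pj qj) → ¬ Separator A InK (ι (v i pi qi)) (ι (v j pj qj)) →
                  (i ≡ 1 × j ≡ 2) ⊎ (i ≡ 2 × j ≡ 1)
  extremes-v₁v₂ {i} {j} pi qi pj qj vᵢ≢vⱼ inseparable with <-cmp i j
  ... | tri< i<j _ _ = inj₁ (ordered-extremes pi qi pj qj i<j inseparable)
  ... | tri≈ _ i≡j _ = ⊥-elim (vᵢ≢vⱼ (ι-v-cong i≡j))
  ... | tri> _ _ j<i = inj₂ (Product.swap (ordered-extremes pj qj pi qi j<i (inseparable ∘ Separator-sym)))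

  vertexAt : Fin N → W
  vertexAt f = ι (v (suc (toℕ f)) (s≤s z≤n) (toℕ<n f))

  K-list : List W
  K-list = map vertexAt (allFin N)

  K-list-unique : Unique K-list
  K-list-unique = Unique.map⁺ vertexAt-injective (Unique.allFin⁺ N)
    where
    vertexAt-injective : ∀ {f g} → vertexAt f ≡ vertexAt g → f ≡ g
    vertexAt-injective e = toℕ-injective (suc-injective (v-injective (ι-injective _ _ e)))

  K-list-length : length K-list ≡ N
  K-list-length = trans (length-map vertexAt (allFin N)) (length-tabulate id)

  K-list-InK : All InK K-list
  K-list-InK = All.map⁺ (All.universal (λ f → suc (toℕ f) , s≤s z≤n , toℕ<n f , refl) (allFin N))

  y∈K-list : old y ∈ K-list
  y∈K-list = subst (_∈ K-list) (ι-v-cong {p′ = s≤s z≤n} {q′ = 3≤N} (cong suc (toℕ-fromℕ< 3≤N)))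
                   (∈-map⁺ vertexAt (∈-allFin (fromℕ< 3≤N)))
    where
    3≤N : 3 ≤ N
    3≤N = s≤s (≤-trans (s≤s (s≤s z≤n)) (m≤n+m _ n))

  module _ (φ : Ordering W) (ce : IsCEOrdering k A φ) where

    open Ordering φ using (_<φ_)
    open CliqueExtendible φ A-sym n ce using (extremes-inseparable)

    y-between-extremes : ∀ {mn c mx} P Q → AllPairs _<φ_ (mn ∷ P ++ c ∷ Q ++ [ mx ]) →
                         All InK (mn ∷ P ++ c ∷ Q ++ [ mx ]) → length P ≡ n → length Q ≡ n →
                         old y ∈ mn ∷ P ++ c ∷ Q ++ [ mx ] → Between φ (old x) (old y) (old z)
    y-between-extremes {mn} {c} {mx} P Q sorted inK |P| |Q| y∈
      with (i , pi , qi , refl) ← All.head inK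
      with (j , pj , qj , refl) ← All.lookup (All.tail inK) (median-last-∈ P Q)
      with extremes-v₁v₂ pi qi pj qj (<φ⇒≢ φ (All.lookup (AllPairs.head sorted) (median-last-∈ P Q)))
             (extremes-inseparable InK-adjacent P Q sorted inK |P| |Q|)
    ... | inj₁ (refl , refl) =
      median-interior-between φ P Q sorted y∈ (x≢y ∘ sym ∘ old-injective) (y≢z ∘ old-injective)
    ... | inj₂ (refl , refl) = Between-sym φ
      (median-interior-between φ P Q sorted y∈ (y≢z ∘ old-injective) (x≢y ∘ sym ∘ old-injective))

    y-between : Between φ (old x) (old y) (old z)
    y-between with sort-strict φ K-list K-list-unique
    ... | cs , sorted , cs↭K with median-split n cs (trans (↭-length cs↭K) (trans K-list-length N-median-length))
    ...   | _ , P , _ , Q , _ , refl , |P| , |Q| = y-between-extremes P Q sorted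
            (All-resp-↭ (↭-sym cs↭K) K-list-InK) |P| |Q| (∈-resp-↭ (↭-sym cs↭K) y∈K-list)

mainTheorem9 : (k : ℕ) → 2 ≤ k → (G : Graph) → Finite G →
    (x y z : V G) → x ≢ y → x ≢ z → y ≢ z →
    (φ : Ordering (CV (V G) k)) → IsCEOrdering k (CkAdj G k x y z) φ →
    Between φ (old x) (old y) (old z)
mainTheorem9 (suc (suc n)) (s≤s (s≤s z≤n)) G _ x y z x≢y x≢z y≢z φ ce =
  Ck.y-between G n x≢y x≢z y≢z φ ce
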